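{- Let $\mathit{accel}$ be the partial function defined on exactly those pairs $(\langle\chi,\vec a\rangle,\check\phi)$ (a loop and a quantifier-free formula over $\vec x$) for which \[ \check\phi(\vec x)\land\chi(\vec a(\vec x))\implies\chi(\vec x) \] is valid, by \[ \mathit{accel}(\langle\chi,\vec a\rangle,\check\phi):=\bigl(\vec x'=\vec a^n(\vec x)\land\chi(\vec a^{n-1}(\vec x))\bigr). \] Then $\mathit{accel}$ is an exact conditional acceleration technique.
   Context: Fix $d\ge 1$, integer variables $\vec x=(x_1,\dots,x_d)$, $\vec x'$, and $n$ ranging over $\mathbb N$; $\vec y=(\vec x,n,\vec x')$. A loop $\langle\chi,\vec a\rangle$ consists of a quantifier-free formula $\chi$ over atoms $p>0$ ($p$ an arithmetic expression over $\vec x$, integer semantics) and a map $\vec a:\mathbb Z^d\to\mathbb Z^d$ given by expressions over $\vec x$; $\vec a^0(\vec x)=\vec x$, $\vec a^{m+1}(\vec x)=\vec a(\vec a^m(\vec x))$. $\vec x\longrightarrow_{\langle\chi,\vec a\rangle}\vec x'$ iff $\chi(\vec x)\land\vec x'=\vec a(\vec x)$, and $\longrightarrow^m$ is its $m$-fold composition. A conditional acceleration technique is a partial function $\mathit{accel}$ from pairs (loop $\langle\chi,\vec a\rangle$, quantifier-free formula $\check\phi$ over $\vec x$) to formulas over $\vec y$. It is sound if for all arguments in its domain, all $\vec x,\vec x'\in\mathbb Z^d$ and all $n>0$, $\vec x\longrightarrow^n_{\langle\check\phi,\vec a\rangle}\vec x'\land\mathit{accel}(\langle\chi,\vec a\rangle,\check\phi)$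 implies $\vec x\longrightarrow^n_{\langle\chi,\vec a\rangle}\vec x'$; it is exact if it is sound and additionally $\vec x\longrightarrow^n_{\langle\chi\land\check\phi,\vec a\rangle}\vec x'$ implies $\mathit{accel}(\langle\chi,\vec a\rangle,\check\phi)$ for all such arguments. Validity means truth for all integer values of the free variables. -}

module Defs where

open import Data.Nat using (ℕ; zero; suc; _∸_; _<_; _≤_)
open import Data.Integer as ℤ using (ℤ)
open import Data.Fin using (Fin)
open import Data.Vec using (Vec; lookup; map)
open import Data.Product using (Σ; _×_)
open import Data.Sum using (_⊎_)
open import Data.Unit using (⊤)
open import Data.Empty using (⊥)
open import Relation.Nullary using (¬_)
open import Relation.Binary.PropositionalEquality using (_≡_)

data Expr (d : ℕ) : Set where
  var   : Fin d → Expr d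
  const : ℤ → Expr d
  _⊕_   : Expr d → Expr d → Expr d
  _⊗_   : Expr d → Expr d → Expr d
  ⊖_    : Expr d → Expr d

eval : ∀ {d} → Expr d → Vec ℤ d → ℤ
eval (var i)   x = lookup x i
eval (const c) x = c
eval (e ⊕ f)   x = eval e x ℤ.+ eval f x
eval (e ⊗ f)   x = eval e x ℤ.* eval f x
eval (⊖ e)     x = ℤ.- eval e x

data Formula (d : ℕ) : Set where
  tt ff : Formula d
  pos   : Expr d → Formula d
  _∧ᶠ_  : Formula d → Formula d → Formula d
  _∨ᶠ_  : Formula d → Formula d → Formula d
  ¬ᶠ_   : Formula d → Formula d

⟦_⟧ : ∀ {d} → Formula d → Vec ℤ d → Set
⟦ tt ⟧     x = ⊤
⟦ ff ⟧     x = ⊥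
⟦ pos p ⟧  x = ℤ.0ℤ ℤ.< eval p x
⟦ φ ∧ᶠ ψ ⟧ x = ⟦ φ ⟧ x × ⟦ ψ ⟧ x
⟦ φ ∨ᶠ ψ ⟧ x = ⟦ φ ⟧ x ⊎ ⟦ ψ ⟧ x
⟦ ¬ᶠ φ ⟧   x = ¬ ⟦ φ ⟧ x

Update : ℕ → Set
Update d = Vec (Expr d) d

apply : ∀ {d} → Update d → Vec ℤ d → Vec ℤ d
apply a x = map (λ e → eval e x) a

iter : ∀ {d} → Update d → ℕ → Vec ℤ d → Vec ℤ d
iter a zero    x = x
iter a (suc m) x = apply a (iter a m x)

record Loop (d : ℕ) : Set where
  constructor ⟨_,_⟩
  field
    guard  : Formula d
    update : Update d
open Loop public

Step : ∀ {d} → Loop d → Vec ℤ d → Vec ℤ d → Set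
Step L x x' = ⟦ guard L ⟧ x × x' ≡ apply (update L) x

Steps : ∀ {d} → Loop d → ℕ → Vec ℤ d → Vec ℤ d → Set
Steps L zero    x x' = x ≡ x'
Steps {d} L (suc m) x x' = Σ (Vec ℤ d) λ z → Step L x z × Steps L m z x'

-- The domain is given by
-- a predicate Dom; the resulting formula is represented by its semantics,
-- a relation on (x, n, x').
Dom : ℕ → Set₁
Dom d = Loop d → Formula d → Set

Accel : ∀ {d} → Dom d → Set₁
Accel {d} D = (L : Loop d) (φ : Formula d) → D L φ → Vec ℤ d → ℕ → Vec ℤ d → Set

Sound : ∀ {d} (D : Dom d) → Accel D → Set
Sound {d} D accel =
  (L : Loop d) (φ : Formula d) (h : D L φ) (x x' : Vec ℤ d) (n : ℕ) → 0 < n →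
  Steps ⟨ φ , update L ⟩ n x x' → accel L φ h x n x' → Steps L n x x'

Exact : ∀ {d} (D : Dom d) → Accel D → Set
Exact {d} D accel =
  Sound D accel ×
  ((L : Loop d) (φ : Formula d) (h : D L φ) (x x' : Vec ℤ d) (n : ℕ) → 0 < n →
   Steps ⟨ guard L ∧ᶠ φ , update L ⟩ n x x' → accel L φ h x n x')

dom7 : ∀ {d} → Dom d
dom7 {d} L φ = (x : Vec ℤ d) → ⟦ φ ⟧ x → ⟦ guard L ⟧ (apply (update L) x) → ⟦ guard L ⟧ x

accel7 : ∀ {d} → Accel {d} dom7
accel7 L φ _ x n x' = x' ≡ iter (update L) n x × ⟦ guard L ⟧ (iter (update L) (n ∸ 1) x)

{-# OPTIONS --safe #-}
module Submission where

open import Defs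
open import Data.Nat using (ℕ; zero; suc; _<_; _≤_; s≤s)
open import Data.Vec using (Vec)
open import Data.Integer using (ℤ)
open import Data.Product using (_,_; proj₁)
open import Relation.Binary.PropositionalEquality using (_≡_; refl; sym; trans; cong; subst)

-- The guard of the accelerated formula is only checked at the last iterate; the domain condition
-- φ̌(x) ∧ χ(a(x)) ⟹ χ(x) then propagates χ backwards along a run of ⟨φ̌, a⟩ to every earlier state.

iter-apply : ∀ {d} (a : Update d) k x → iter a k (apply a x) ≡ iter a (suc k) x
iter-apply a zero    x = refl
iter-apply a (suc k) x = cong (apply a) (iter-apply a k x)

Steps⇒iter : ∀ {d} (L : Loop d) m {x x'} → Steps L m x x' → x' ≡ iter (update L) m x
Steps⇒iter L zero    refl                 = refl
Steps⇒iter L (suc m) (z , (_ , refl) , s) = trans (Steps⇒iter L m s) (iter-apply (update L) m _)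

Steps⇒last-guard : ∀ {d} (L : Loop d) m {x x'} →
  Steps L (suc m) x x' → ⟦ guard L ⟧ (iter (update L) m x)
Steps⇒last-guard L zero    (_ , (g , _) , _)    = g
Steps⇒last-guard L (suc m) (z , (_ , refl) , s) =
  subst ⟦ guard L ⟧ (iter-apply (update L) m _) (Steps⇒last-guard L m s)

Steps-backward-guard : ∀ {d} {ψ χ : Formula d} {a : Update d} →
  (∀ x → ⟦ ψ ⟧ x → ⟦ χ ⟧ (apply a x) → ⟦ χ ⟧ x) →
  ∀ m {x x'} → Steps ⟨ ψ , a ⟩ (suc m) x x' → ⟦ χ ⟧ (iter a m x) → Steps ⟨ χ , a ⟩ (suc m) x x'
Steps-backward-guard inv zero    (z , (_ , e) , s) χ-last = z , (χ-last , e) , s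
Steps-backward-guard {χ = χ} {a} inv (suc m) {x} (z , (ψx , refl) , s) χ-last
  with Steps-backward-guard inv m s (subst ⟦ χ ⟧ (sym (iter-apply a m x)) χ-last)
... | rest@(_ , (χz , _) , _) = z , (inv x ψx χz , refl) , rest

accel7-sound : ∀ {d} → Sound {d} dom7 accel7
accel7-sound L φ inv x x' (suc m) (s≤s _) run (_ , χ-last) = Steps-backward-guard inv m run χ-last

accel7-complete : ∀ {d} (L : Loop d) (φ : Formula d) (h : dom7 L φ) (x x' : Vec ℤ d) (n : ℕ) → 0 < n →
  Steps ⟨ guard L ∧ᶠ φ , update L ⟩ n x x' → accel7 L φ h x n x'
accel7-complete L φ _ x x' (suc m) (s≤s _) run =
  Steps⇒iter ⟨ guard L ∧ᶠ φ , update L ⟩ (suc m) run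
  , proj₁ (Steps⇒last-guard ⟨ guard L ∧ᶠ φ , update L ⟩ m run)

theorem7 : (d : ℕ) → 1 ≤ d → Exact {d} dom7 accel7
theorem7 d _ = accel7-sound , accel7-complete
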